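{- Let $\mathcal{C}^{\mathbf{pre}}_{\mathbf{ud}}$ be the class of all prestandard frames that are up and down reflexive and up and down symmetric, and let $\mathcal{C}^{\mathbf{sta}}_{\mathbf{ud}}$ be the class of all standard frames that are up and down reflexive and up and down symmetric. Then $\mathtt{Log}(\mathcal{C}^{\mathbf{pre}}_{\mathbf{ud}})=\mathtt{Log}(\mathcal{C}^{\mathbf{sta}}_{\mathbf{ud}})$. Here: - a frame is up and down reflexive if for every group $\alpha$ and every $s$, $s\,(\leq\circ R(\alpha)\circ\leq)\,s$ and $s\,(\geq\circ R(\alpha)\circ\geq)\,s$; - it is up and down symmetric if for every group $\alpha$ and all $s,t$, $sR(\alpha)t$ implies $t\,(\leq\circ R(\alpha)\circ\leq)\,s$ and $t\,(\geq\circ R(\alpha)\circ\geq)\,s$; - it is prestandard if $R(\alpha\cup\beta)\subseteq R(\alpha)\cap R(\beta)$ for all groups $\alpha,\beta$; - it is standard if equality holds instead.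
   Context: **Language.** Let $\mathbf{At}$ be a countably infinite set of atoms and let $\mathbf{Ag}$ be a finite set of agents. A group is a nonempty subset of $\mathbf{Ag}$. Formulas are generated by $$A ::= p \mid (A\rightarrow A) \mid \top \mid \bot \mid (A\vee A) \mid (A\wedge A) \mid [\alpha]A \mid \langle\alpha\rangle A.$$ **Frames.** A frame is a triple $(W,\leq,R)$ where $W$ is a nonempty set, $\leq$ is a preorder on $W$, and $R$ assigns to each group $\alpha$ a binary relation $R(\alpha)$ on $W$. For binary relations $S,T$, write $s\,(S\circ T)\,t$ iff there is $u$ with $sSu$ and $uTt$. Write $\geq$ for the converse of $\leq$. **Models and satisfaction.** A valuation is a map $V:\mathbf{At}\to\wp(W)$ with each $V(p)$ upward closed under $\leq$. Satisfaction in a model $(W,\leq,R,V)$ is defined as follows: - $s\models p$ iff $s\in V(p)$; - $s\models A\rightarrow B$ iff for all $t\geq s$, either $t\not\models A$ or $t\models B$; - $s\models\top$, and $s\not\models\bot$; - $\vee$ and $\wedge$ are interpreted pointwise; - $s\models[\alpha]A$ iff for all $t$ with $s\,(\leq\circ R(\alpha))\,t$, $t\models A$; - $s\models\langle\alpha\rangle A$ iff there is $t$ with $s\,(\geq\circ R(\alpha))\,t$ and $t\models A$. A formula is valid in a frame if it is satisfied at every state of every model based on that frame. For a class $\mathcal{C}$ of frames, $\mathtt{Log}(\mathcal{C})$ is the set of formulas valid in every frame in $\mathcal{C}$. -}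

module Defs where

open import Data.Nat using (ℕ)
open import Data.Fin.Subset using (Subset; Nonempty; _∪_)
open import Data.Product using (_×_; Σ; ∃; _,_)
open import Data.Sum using (_⊎_)
open import Data.Unit using (⊤)
open import Data.Empty using (⊥)
open import Relation.Nullary using (¬_)
open import Level using () renaming (suc to lsuc; zero to lzero)

-- Atoms: ℕ (countably infinite). Agents: Fin n for a finite n.
-- Groups: nonempty subsets of Fin n (Subset n together with a Nonempty proof).

data Form (n : ℕ) : Set where
  atom : ℕ → Form n
  _⇒_  : Form n → Form n → Form n
  ⊤f ⊥f : Form n
  _∨f_ _∧f_ : Form n → Form n → Form n
  box dia : (α : Subset n) → Nonempty α → Form n → Form n

_∘ʳ_ : {W : Set} → (W → W → Set) → (W → W → Set) → W → W → Set
(S ∘ʳ T) s t = ∃ λ u → S s u × T u t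

-- Frame over Ag = Fin n: preorder ≤ and a relation R α for each subset α
-- (only the values on nonempty α, i.e. groups, are ever used/constrained).
record Frame (n : ℕ) : Set₁ where
  field
    W     : Set
    w₀    : W
    _≤_   : W → W → Set
    ≤-refl  : ∀ s → s ≤ s
    ≤-trans : ∀ {s t u} → s ≤ t → t ≤ u → s ≤ u
    R     : Subset n → W → W → Set

  _≥_ : W → W → Set
  s ≥ t = t ≤ s

module _ {n : ℕ} (F : Frame n) where
  open Frame F

  UpClosed : (W → Set) → Set
  UpClosed P = ∀ {s t} → s ≤ t → P s → P t

  Valuation : Set₁
  Valuation = Σ (ℕ → W → Set) λ V → ∀ p → UpClosed (V p)

  Sat : (ℕ → W → Set) → W → Form n → Set
  Sat V s (atom p)  = V p s
  Sat V s (A ⇒ B)   = ∀ t → s ≤ t → Sat V t A → Sat V t B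
  Sat V s ⊤f        = ⊤
  Sat V s ⊥f        = ⊥
  Sat V s (A ∨f B)  = Sat V s A ⊎ Sat V s B
  Sat V s (A ∧f B)  = Sat V s A × Sat V s B
  Sat V s (box α _ A) = ∀ t → (_≤_ ∘ʳ R α) s t → Sat V t A
  Sat V s (dia α _ A) = ∃ λ t → (_≥_ ∘ʳ R α) s t × Sat V t A

  Valid : Form n → Set₁
  Valid A = ((V , _) : Valuation) → ∀ s → Sat V s A

  UpDownReflexive : Set
  UpDownReflexive = ∀ α → Nonempty α → ∀ s →
    ((_≤_ ∘ʳ R α) ∘ʳ _≤_) s s × ((_≥_ ∘ʳ R α) ∘ʳ _≥_) s s

  UpDownSymmetric : Set
  UpDownSymmetric = ∀ α → Nonempty α → ∀ s t → R α s t →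
    ((_≤_ ∘ʳ R α) ∘ʳ _≤_) t s × ((_≥_ ∘ʳ R α) ∘ʳ _≥_) t s

  Prestandard : Set
  Prestandard = ∀ α β → Nonempty α → Nonempty β → ∀ s t →
    R (α ∪ β) s t → R α s t × R β s t

  Standard : Set
  Standard = ∀ α β → Nonempty α → Nonempty β → ∀ s t →
    (R (α ∪ β) s t → R α s t × R β s t) × (R α s t × R β s t → R (α ∪ β) s t)

InCpreUD : {n : ℕ} → Frame n → Set
InCpreUD F = Prestandard F × UpDownReflexive F × UpDownSymmetric F

InCstaUD : {n : ℕ} → Frame n → Set
InCstaUD F = Standard F × UpDownReflexive F × UpDownSymmetric F

InLog : {n : ℕ} → (Frame n → Set) → Form n → Set₁
InLog C A = ∀ F → C F → Valid F A

-- Every standard frame is prestandard, so one inclusion of logics is immediate.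
-- For the other, a prestandard frame F is unravelled into a standard one whose
-- worlds are pairs (s , m) of a world and a group label, with
--   (s , l) R'(γ) (t , m)  iff  m is a group, γ ⊆ m and s R(m) t.
-- Then R'(γ ∪ δ) = R'(γ) ∩ R'(δ) because γ ∪ δ ⊆ m iff γ ⊆ m and δ ⊆ m.
-- Prestandardness makes R antitone in the group, so forgetting the labels
-- preserves truth, and up/down reflexivity and symmetry lift to the labelled
-- frame. Hence a formula valid on all standard frames in the class is valid on F.
module Submission where

open import Defs
open import Data.Nat using (ℕ)
open import Data.Product as Product using (_×_; _,_; proj₁)
open import Data.Sum as Sum using ([_,_])
open import Data.Fin.Subset using (Subset; Nonempty; _∪_; _⊆_; ⊥)
open import Data.Fin.Subset.Properties
  using (p⊆p∪q; q⊆p∪q; x∈p∪q⁻; ⊆-refl; ⊆-antisym)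
open import Function using (id; _∘_)
open import Function.Bundles using (_⇔_; mk⇔; Equivalence)
open import Relation.Binary.PropositionalEquality using (_≡_; subst)

open Equivalence using (to; from)

∪-lub : ∀ {n} {p q r : Subset n} → p ⊆ r → q ⊆ r → p ∪ q ⊆ r
∪-lub {p = p} {q} p⊆r q⊆r x∈p∪q = [ p⊆r , q⊆r ] (x∈p∪q⁻ p q x∈p∪q)

InLog-antitone : ∀ {n} {C D : Frame n → Set} {A : Form n} →
                 (∀ F → C F → D F) → InLog D A → InLog C A
InLog-antitone C⊆D validD F CF = validD F (C⊆D F CF)

module _ {n : ℕ} (F : Frame n) where
  open Frame F

  standard⇒prestandard : Standard F → Prestandard F
  standard⇒prestandard std α β nα nβ s t = proj₁ (std α β nα nβ s t)

  prestandard⇒R-antitone : Prestandard F → ∀ {α m} → Nonempty α → Nonempty m →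
                           α ⊆ m → ∀ {s t} → R m s t → R α s t
  prestandard⇒R-antitone pre {α} {m} nα nm α⊆m {s} {t} r =
    proj₁ (pre α m nα nm s t (subst (λ γ → R γ s t) m≡α∪m r))
    where
      m≡α∪m : m ≡ α ∪ m
      m≡α∪m = ⊆-antisym (q⊆p∪q α m) (∪-lub α⊆m ⊆-refl)

module Labelled {n : ℕ} (F : Frame n) where
  open Frame F

  R′ : Subset n → W × Subset n → W × Subset n → Set
  R′ γ (s , _) (t , m) = Nonempty m × γ ⊆ m × R m s t

  labelled : Frame n
  labelled = record
    { W       = W × Subset n
    ; w₀      = w₀ , ⊥
    ; _≤_     = λ x y → proj₁ x ≤ proj₁ y
    ; ≤-refl  = ≤-refl ∘ proj₁
    ; ≤-trans = ≤-trans
    ; R       = R′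
    }

  labelled-standard : Standard labelled
  labelled-standard α β _ _ _ _ =
    (λ (nm , α∪β⊆m , r) →
       (nm , α∪β⊆m ∘ p⊆p∪q β , r) , (nm , α∪β⊆m ∘ q⊆p∪q α β , r))
    , λ ((nm , α⊆m , r) , (_ , β⊆m , _)) → nm , ∪-lub α⊆m β⊆m , r

  module _ {α m : Subset n} (nm : Nonempty m) (α⊆m : α ⊆ m) where
    open Frame labelled using () renaming (_≤_ to _≤′_; _≥_ to _≥′_)

    lift-up : ∀ {s t} → ((_≤_ ∘ʳ R m) ∘ʳ _≤_) s t →
              ∀ l k → ((_≤′_ ∘ʳ R′ α) ∘ʳ _≤′_) (s , l) (t , k)
    lift-up (v , (u , s≤u , r) , v≤t) l k =
      (v , m) , ((u , l) , s≤u , nm , α⊆m , r) , v≤t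

    lift-down : ∀ {s t} → ((_≥_ ∘ʳ R m) ∘ʳ _≥_) s t →
                ∀ l k → ((_≥′_ ∘ʳ R′ α) ∘ʳ _≥′_) (s , l) (t , k)
    lift-down (v , (u , u≤s , r) , t≤v) l k =
      (v , m) , ((u , l) , u≤s , nm , α⊆m , r) , t≤v

  labelled-upDownReflexive : UpDownReflexive F → UpDownReflexive labelled
  labelled-upDownReflexive udr α nα (s , l) =
    Product.map (λ up → lift-up nα ⊆-refl up l l)
                (λ down → lift-down nα ⊆-refl down l l)
                (udr α nα s)

  labelled-upDownSymmetric : UpDownSymmetric F → UpDownSymmetric labelled
  labelled-upDownSymmetric uds α _ (s , l) (t , m) (nm , α⊆m , r) =
    Product.map (λ up → lift-up nm α⊆m up m l)
                (λ down → lift-down nm α⊆m down m l)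
                (uds m nm s t r)

  V′ : (ℕ → W → Set) → ℕ → W × Subset n → Set
  V′ V p = V p ∘ proj₁

  module _ (pre : Prestandard F) (V : ℕ → W → Set) where
    Sat-forget : ∀ A s l → Sat labelled (V′ V) (s , l) A ⇔ Sat F V s A
    Sat-forget (atom p) s l = mk⇔ id id
    Sat-forget ⊤f s l = mk⇔ id id
    Sat-forget ⊥f s l = mk⇔ id id
    Sat-forget (A ∨f B) s l =
      mk⇔ (Sum.map (to (Sat-forget A s l)) (to (Sat-forget B s l)))
          (Sum.map (from (Sat-forget A s l)) (from (Sat-forget B s l)))
    Sat-forget (A ∧f B) s l =
      mk⇔ (Product.map (to (Sat-forget A s l)) (to (Sat-forget B s l)))
          (Product.map (from (Sat-forget A s l)) (from (Sat-forget B s l)))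
    Sat-forget (A ⇒ B) s l = mk⇔
      (λ h t s≤t a → to (Sat-forget B t l) (h (t , l) s≤t (from (Sat-forget A t l) a)))
      (λ h (t , m) s≤t a → from (Sat-forget B t m) (h t s≤t (to (Sat-forget A t m) a)))
    Sat-forget (box α nα A) s l = mk⇔
      (λ h t (u , s≤u , r) →
         to (Sat-forget A t α) (h (t , α) ((u , l) , s≤u , nα , ⊆-refl , r)))
      (λ h (t , m) (_ , s≤u , nm , α⊆m , r) →
         from (Sat-forget A t m)
              (h t (_ , s≤u , prestandard⇒R-antitone F pre nα nm α⊆m r)))
    Sat-forget (dia α nα A) s l = mk⇔
      (λ ((t , m) , (_ , u≤s , nm , α⊆m , r) , a) →
         t , (_ , u≤s , prestandard⇒R-antitone F pre nα nm α⊆m r)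
           , to (Sat-forget A t m) a)
      (λ (t , (u , u≤s , r) , a) →
         (t , α) , ((u , l) , u≤s , nα , ⊆-refl , r) , from (Sat-forget A t α) a)

  labelled-valid⇒valid : Prestandard F → ∀ A → Valid labelled A → Valid F A
  labelled-valid⇒valid pre A valid (V , up) s =
    to (Sat-forget pre V A s ⊥) (valid (V′ V , λ p → up p) (s , ⊥))

proposition11 : (n : ℕ) → (A : Form n) →
    (InLog InCpreUD A → InLog InCstaUD A) × (InLog InCstaUD A → InLog InCpreUD A)
proposition11 n A =
    InLog-antitone {A = A} (λ F → Product.map₁ (standard⇒prestandard F))
  , λ validSta F (pre , udr , uds) →
      let open Labelled F in
      labelled-valid⇒valid pre A
        (validSta labelled (labelled-standard , labelled-upDownReflexive udr
                                              , labelled-upDownSymmetric uds))
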